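{- Let $n=p_1p_2\cdots p_r$, where $r\geq 3$ and $p_1<p_2<\cdots<p_r$ are prime numbers. Then $$\delta(\mathcal{P}(C_n))=\min\{\deg(p_{r-1}p_r),\ \deg(p_r)\}.$$ Further, $\delta(\mathcal{P}(C_n))=\deg(p_r)$ if and only if $$\phi(p_r)\geq\left(\frac{p_1p_2\cdots p_{r-2}}{\phi(p_1p_2\cdots p_{r-2})}-1\right)\phi(p_{r-1}).$$ In particular, if $\phi(p_r)\geq (r-2)\phi(p_{r-1})$, then $\delta(\mathcal{P}(C_n))=\deg(p_r)$.
   Context: For a finite group $G$, the power graph $\mathcal{P}(G)$ is the simple undirected graph with vertex set $G$ in which two distinct vertices are adjacent if one of them is an integral power of the other. $C_n$ denotes the cyclic group of order $n$, identified with $\mathbb{Z}_n=\{0,1,\ldots,n-1\}$ (so "powers" are integer multiples modulo $n$); a positive divisor $d$ of $n$ is regarded as the vertex $d \bmod n$ of $\mathcal{P}(C_n)$. $\deg(a)$ denotes the degree of vertex $a$ in $\mathcal{P}(C_n)$, $\delta(\mathcal{P}(C_n))$ the minimum degree, and $\phi$ Euler's totient function. -}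

module Defs where

open import Data.Nat using (ℕ; zero; suc; _+_; _*_; _∸_; _<_; _≤_; _⊓_)
open import Data.Nat.Properties using (_≟_)
open import Data.Nat.DivMod using (_%_; _mod_)
open import Data.Nat.GCD using (gcd)
open import Data.Fin using (Fin; toℕ)
open import Data.Fin.Properties using (any?) renaming (_≟_ to _≟ᶠ_)
open import Data.List using (List; length; filter; map; foldr)
open import Data.List.Base using (allFin)
open import Data.Product using (Σ; _×_)
open import Data.Sum using (_⊎_)
open import Relation.Nullary using (Dec; ¬_)
open import Relation.Nullary.Decidable using (_×-dec_; _⊎-dec_; ¬?)
open import Relation.Binary.PropositionalEquality using (_≡_; _≢_)
open import Data.Integer using (+_)
open import Data.Rational using (ℚ; 0ℚ; _/_)

prodUpTo : (ℕ → ℕ) → ℕ → ℕ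
prodUpTo p zero = 1
prodUpTo p (suc m) = prodUpTo p m * p (suc m)

φ : ℕ → ℕ
φ n = length (filter (λ (k : Fin n) → gcd (suc (toℕ k)) n ≟ 1) (allFin n))

-- a/b as a rational number (only used with b ≠ 0; the b = 0 clause is a dummy)
_÷ℕ_ : ℕ → ℕ → ℚ
a ÷ℕ zero = 0ℚ
a ÷ℕ suc b = (+ a) / suc b

-- Power graph of the cyclic group C_(suc m) = ℤ_(suc m) (written additively),
-- vertices Fin (suc m).

-- b is an integral power (= integer multiple) of a in ℤ_(suc m).
-- Integer multiples k·a, k ∈ ℤ, are exactly k·a with 0 ≤ k < suc m.
IsPow : (m : ℕ) → Fin (suc m) → Fin (suc m) → Set
IsPow m a b = Σ (Fin (suc m)) λ k → (toℕ k * toℕ a) % suc m ≡ toℕ b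

isPow? : (m : ℕ) → (a b : Fin (suc m)) → Dec (IsPow m a b)
isPow? m a b = any? (λ k → ((toℕ k * toℕ a) % suc m) ≟ toℕ b)

Adj : (m : ℕ) → Fin (suc m) → Fin (suc m) → Set
Adj m a b = a ≢ b × (IsPow m a b ⊎ IsPow m b a)

adj? : (m : ℕ) → (a b : Fin (suc m)) → Dec (Adj m a b)
adj? m a b = ¬? (a ≟ᶠ b) ×-dec (isPow? m a b ⊎-dec isPow? m b a)

degFin : (m : ℕ) → Fin (suc m) → ℕ
degFin m a = length (filter (adj? m a) (allFin (suc m)))

-- deg n x : degree in P(C_n) of the vertex (x mod n); n = 0 is a dummy case
deg : ℕ → ℕ → ℕ
deg zero x = 0
deg (suc m) x = degFin m (x mod suc m)

δ : ℕ → ℕ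
δ zero = 0
δ (suc m) = foldr _⊓_ (degFin m Fin.zero) (map (degFin m) (allFin (suc m)))

module Submission where

-- A vertex x with g = gcd(x, N) and cofactor m = N / g is adjacent to the y ≠ x with g ∣ y
-- (the powers of x) or gcd(y, m) = 1 (the y having x as a power), so by inclusion–exclusion
-- deg x = m + (g - 1) φ(m) - 1 (module DegreeFormula).
-- A vertex is thus described by how the primes split between m and g (data Split), and its
-- degree only by the profile (m, g, φ(m)).  Exchanging a cofactor prime with a larger gcd
-- prime never lowers the degree, and two estimates settle the remaining configurations, so
-- every vertex is at least as expensive as p r or p (r-1) p r (module Minimum).  Hence
-- δ = min(deg(p (r-1) p r), deg(p r)); comparing these two degrees and clearing denominators
-- gives the rational criterion, and P ≤ (r - 1) φ(P) for P = p 1 ⋯ p (r-2) the sufficient one.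

open import Defs
open import Data.Nat using (ℕ; _<_; _≤_; _∸_; _*_; _⊓_)
open import Data.Nat.Primality using (Prime)
open import Data.Product using (_×_)
open import Data.Rational using (_-_; 1ℚ) renaming (_≤_ to _≤ℚ_; _*_ to _*ℚ_)
open import Relation.Binary.PropositionalEquality using (_≡_)
open import Function.Bundles using (_⇔_)

open import Data.Nat
open import Data.Nat.Properties
open import Data.Nat.Divisibility
open import Data.Nat.DivMod using (_%_; _mod_; [m+kn]%n≡m%n; m<n⇒m%n≡m; m%n<n; %-distribˡ-*; m%n%n≡m%n)
open import Data.Nat.GCD using (gcd; gcd[m,n]∣m; gcd[m,n]∣n; gcd-greatest; gcd[m,n]≢0; gcd-GCD; module Bézout)
open import Data.Nat.Coprimality using (Coprime; coprime?; coprime-+; coprime-divisor; gcd≡1⇒coprime; coprime⇒gcd≡1)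
import Data.Nat.Coprimality as Coprime
open import Data.Nat.Primality using (prime⇒irreducible; prime⇒nonTrivial; prime⇒nonZero; euclidsLemma)
open import Data.Nat.Tactic.RingSolver using (solve-∀)
open import Data.Bool using (Bool; true; false; _∧_; _∨_; not)
open import Data.Bool.Properties using (∧-comm; ∧-identityʳ)
open import Data.Fin using (Fin; toℕ; fromℕ<)
import Data.Fin as Fin
open import Data.Fin.Properties using (toℕ-fromℕ<; toℕ<n; toℕ-injective) renaming (_≟_ to _≟ᶠ_)
open import Data.List using ([]; _∷_; length; filter; tabulate; map; foldr; allFin)
open import Data.List.Membership.Propositional using (_∈_)
open import Data.List.Membership.Propositional.Properties using (∈-allFin)
open import Data.List.Relation.Unary.Any using (here; there)
open import Data.Product using (_,_; Σ; proj₁; proj₂)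
open import Data.Sum using (_⊎_; inj₁; inj₂) renaming (map to map⊎)
open import Data.Empty using (⊥-elim)
open import Relation.Nullary using (does; yes; no; ¬_; _×-dec_; ¬?)
open import Relation.Nullary.Decidable using (dec-true; dec-false; does-⇔)
open import Relation.Unary using (Pred; Decidable)
open import Relation.Binary.PropositionalEquality
open import Level using (0ℓ)
open import Function using (_∘_; id; mk⇔; Equivalence)
import Function.Properties.Equivalence as ⇔
open import Algebra.Properties.CommutativeSemigroup +-commutativeSemigroup using ()
  renaming (interchange to +-interchange; xy∙z≈xz∙y to +-swapʳ)
open import Algebra.Properties.CommutativeSemigroup *-commutativeSemigroup using ()
  renaming (xy∙z≈xz∙y to *-swapʳ)

ind : Bool → ℕ
ind true = 1
ind false = 0

count : (ℕ → Bool) → ℕ → ℕ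
count b zero = 0
count b (suc n) = ind (b 0) + count (b ∘ suc) n

count-cong : ∀ n {b c : ℕ → Bool} → (∀ i → i < n → b i ≡ c i) → count b n ≡ count c n
count-cong zero eq = refl
count-cong (suc n) eq =
  cong₂ _+_ (cong ind (eq 0 z<s)) (count-cong n (λ i i<n → eq (suc i) (s<s i<n)))

count-none : ∀ n {b : ℕ → Bool} → (∀ i → i < n → b i ≡ false) → count b n ≡ 0
count-none zero none = refl
count-none (suc n) none rewrite none 0 z<s = count-none n (λ i i<n → none (suc i) (s<s i<n))

count-+ : ∀ m n (b : ℕ → Bool) → count b (m + n) ≡ count b m + count (λ i → b (m + i)) n
count-+ zero n b = refl
count-+ (suc m) n b = trans (cong (ind (b 0) +_) (count-+ m n (b ∘ suc))) (sym (+-assoc (ind (b 0)) _ _))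

count-shift : ∀ n (b : ℕ → Bool) → b 0 ≡ b n → count (b ∘ suc) n ≡ count b n
count-shift n b b0≡bn = +-cancelˡ-≡ (ind (b 0)) _ _ (begin
  count b (suc n)                 ≡⟨ cong (count b) (+-comm 1 n) ⟩
  count b (n + 1)                 ≡⟨ count-+ n 1 b ⟩
  count b n + (ind (b (n + 0)) + 0) ≡⟨ cong (λ k → count b n + (ind (b k) + 0)) (+-identityʳ n) ⟩
  count b n + (ind (b n) + 0)     ≡⟨ cong (count b n +_) (+-identityʳ _) ⟩
  count b n + ind (b n)           ≡⟨ +-comm (count b n) _ ⟩
  ind (b n) + count b n           ≡⟨ cong (λ x → ind x + count b n) (sym b0≡bn) ⟩
  ind (b 0) + count b n           ∎)
  where open ≡-Reasoning

count-periodic : ∀ g m (b : ℕ → Bool) → (∀ i → b (m + i) ≡ b i) → count b (g * m) ≡ g * count b m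
count-periodic zero m b periodic = refl
count-periodic (suc g) m b periodic = begin
  count b (m + g * m)                      ≡⟨ count-+ m (g * m) b ⟩
  count b m + count (λ i → b (m + i)) (g * m) ≡⟨ cong (count b m +_) (count-cong (g * m) (λ i _ → periodic i)) ⟩
  count b m + count b (g * m)              ≡⟨ cong (count b m +_) (count-periodic g m b periodic) ⟩
  count b m + g * count b m                ∎
  where open ≡-Reasoning

count-additive : ∀ n (b c d e : ℕ → Bool) → (∀ i → ind (b i) + ind (c i) ≡ ind (d i) + ind (e i))
               → count b n + count c n ≡ count d n + count e n
count-additive zero b c d e pointwise = refl
count-additive (suc n) b c d e pointwise = begin
  (ind (b 0) + count (b ∘ suc) n) + (ind (c 0) + count (c ∘ suc) n)
    ≡⟨ +-interchange (ind (b 0)) _ _ _ ⟩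
  (ind (b 0) + ind (c 0)) + (count (b ∘ suc) n + count (c ∘ suc) n)
    ≡⟨ cong₂ _+_ (pointwise 0) (count-additive n (b ∘ suc) (c ∘ suc) (d ∘ suc) (e ∘ suc) (pointwise ∘ suc)) ⟩
  (ind (d 0) + ind (e 0)) + (count (d ∘ suc) n + count (e ∘ suc) n)
    ≡⟨ +-interchange (ind (d 0)) _ _ _ ⟩
  (ind (d 0) + count (d ∘ suc) n) + (ind (e 0) + count (e ∘ suc) n) ∎
  where open ≡-Reasoning

count-∨-∧ : ∀ n (b c : ℕ → Bool) → count (λ i → b i ∨ c i) n + count (λ i → b i ∧ c i) n ≡ count b n + count c n
count-∨-∧ n b c = count-additive n _ _ b c (λ i → pointwise (b i) (c i))
  where
  pointwise : ∀ x y → ind (x ∨ y) + ind (x ∧ y) ≡ ind x + ind y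
  pointwise true true = refl
  pointwise true false = refl
  pointwise false true = refl
  pointwise false false = refl

count-split : ∀ n (b c : ℕ → Bool) → count (λ i → b i ∧ not (c i)) n + count (λ i → b i ∧ c i) n ≡ count b n
count-split n b c = begin
  count (λ i → b i ∧ not (c i)) n + count (λ i → b i ∧ c i) n ≡⟨ count-additive n _ _ b (λ _ → false) (λ i → pointwise (b i) (c i)) ⟩
  count b n + count (λ _ → false) n                          ≡⟨ cong (count b n +_) (count-none n (λ _ _ → refl)) ⟩
  count b n + 0                                              ≡⟨ +-identityʳ _ ⟩
  count b n                                                  ∎
  where
  open ≡-Reasoning
  pointwise : ∀ x y → ind (x ∧ not y) + ind (x ∧ y) ≡ ind x + 0
  pointwise true true = refl
  pointwise true false = refl
  pointwise false y = refl

count-remove : ∀ n x (b : ℕ → Bool) → x < n → b x ≡ true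
             → count (λ i → not (does (i ≟ x)) ∧ b i) n + 1 ≡ count b n
count-remove (suc n) zero b _ bx =
  trans (+-comm _ 1) (cong₂ _+_ (cong ind (sym bx)) (count-cong n (λ i _ → refl)))
count-remove (suc n) (suc x) b (s<s x<n) bx =
  trans (+-assoc (ind (b 0)) _ 1) (cong (ind (b 0) +_) (count-remove n x (b ∘ suc) x<n bx))

_∣ᵇ_ : ℕ → ℕ → Bool
g ∣ᵇ y = does (g ∣? y)

∣ᵇ-periodic : ∀ g i → g ∣ᵇ (g + i) ≡ g ∣ᵇ i
∣ᵇ-periodic g i = does-⇔ (mk⇔ (λ g∣g+i → ∣m+n∣m⇒∣n g∣g+i ∣-refl) (∣m∣n⇒∣m+n ∣-refl)) (g ∣? (g + i)) (g ∣? i)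

-- The multiples of g below m * g are the t * g with t < m, so counting them
-- subject to h amounts to counting the t < m with h (t * g).
count-multiples : ∀ m g .{{_ : NonZero g}} (h : ℕ → Bool)
                → count (λ y → g ∣ᵇ y ∧ h y) (m * g) ≡ count (λ t → h (t * g)) m
count-multiples zero g h = refl
count-multiples (suc m) g@(suc g') h = begin
  count (λ y → g ∣ᵇ y ∧ h y) (g + m * g)
    ≡⟨ count-+ g (m * g) (λ y → g ∣ᵇ y ∧ h y) ⟩
  count (λ y → g ∣ᵇ y ∧ h y) g + count (λ y → g ∣ᵇ (g + y) ∧ h (g + y)) (m * g)
    ≡⟨ cong₂ _+_ first-period (count-cong (m * g) (λ y _ → cong (_∧ h (g + y)) (∣ᵇ-periodic g y))) ⟩
  ind (h 0) + count (λ y → g ∣ᵇ y ∧ h (g + y)) (m * g)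
    ≡⟨ cong (ind (h 0) +_) (count-multiples m g (λ y → h (g + y))) ⟩
  ind (h 0) + count (λ t → h (g + t * g)) m ∎
  where
  open ≡-Reasoning
  nonmultiple : ∀ i → i < g' → g ∣ᵇ suc i ≡ false
  nonmultiple i i<g' = dec-false (g ∣? suc i) (λ g∣1+i → <⇒≱ (s<s i<g') (∣⇒≤ g∣1+i))
  first-period : count (λ y → g ∣ᵇ y ∧ h y) g ≡ ind (h 0)
  first-period rewrite dec-true (g ∣? 0) (g ∣0) =
    trans (cong (ind (h 0) +_) (count-none g' (λ i i<g' → cong (_∧ h (suc i)) (nonmultiple i i<g')))) (+-identityʳ _)

count-all : ∀ n → count (λ _ → true) n ≡ n
count-all zero = refl
count-all (suc n) = cong suc (count-all n)

count-multiples-all : ∀ m g .{{_ : NonZero g}} → count (g ∣ᵇ_) (m * g) ≡ m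
count-multiples-all m g = begin
  count (g ∣ᵇ_) (m * g)                ≡⟨ count-cong (m * g) (λ y _ → sym (∧-identityʳ (g ∣ᵇ y))) ⟩
  count (λ y → g ∣ᵇ y ∧ true) (m * g)  ≡⟨ count-multiples m g (λ _ → true) ⟩
  count (λ _ → true) m                 ≡⟨ count-all m ⟩
  m                                    ∎
  where open ≡-Reasoning

length-filter-tabulate : ∀ {A : Set} n (f : Fin n → A) {P : Pred A 0ℓ} (P? : Decidable P) (b : ℕ → Bool)
                       → (∀ i → does (P? (f i)) ≡ b (toℕ i)) → length (filter P? (tabulate f)) ≡ count b n
length-filter-tabulate zero f P? b agree = refl
length-filter-tabulate (suc n) f P? b agree with does (P? (f Fin.zero)) | agree Fin.zero
... | true  | b0 rewrite sym b0 = cong suc (length-filter-tabulate n (f ∘ Fin.suc) P? (b ∘ suc) (agree ∘ Fin.suc))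
... | false | b0 rewrite sym b0 = length-filter-tabulate n (f ∘ Fin.suc) P? (b ∘ suc) (agree ∘ Fin.suc)

coprimeᵇ : ℕ → ℕ → Bool
coprimeᵇ y m = does (coprime? y m)

φ′ : ℕ → ℕ
φ′ N = count (λ y → coprimeᵇ y N) N

coprimeᵇ-periodic : ∀ N i → coprimeᵇ (N + i) N ≡ coprimeᵇ i N
coprimeᵇ-periodic N i = does-⇔ (mk⇔ drop-N coprime-+) (coprime? (N + i) N) (coprime? i N)
  where
  drop-N : Coprime (N + i) N → Coprime i N
  drop-N c (d∣i , d∣N) = c (∣m∣n⇒∣m+n d∣N d∣i , d∣N)

-- φ counts 1 ≤ k ≤ N, φ′ counts 0 ≤ k < N; the endpoints 0 and N agree.
φ≡φ′ : ∀ N → φ N ≡ φ′ N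
φ≡φ′ N = trans
  (length-filter-tabulate N (λ k → k) (λ k → gcd (suc (toℕ k)) N ≟ 1) (λ i → coprimeᵇ (suc i) N)
     (λ i → does-⇔ (mk⇔ gcd≡1⇒coprime coprime⇒gcd≡1) (gcd (suc (toℕ i)) N ≟ 1) (coprime? (suc (toℕ i)) N)))
  (count-shift N (λ y → coprimeᵇ y N) coprime-0-N)
  where
  coprime-0-N : coprimeᵇ 0 N ≡ coprimeᵇ N N
  coprime-0-N = trans (sym (coprimeᵇ-periodic N 0)) (cong (λ k → coprimeᵇ k N) (+-identityʳ N))

prime⇒≢1 : ∀ {q} → Prime q → q ≢ 1
prime⇒≢1 pq = nonTrivial⇒≢1 {{prime⇒nonTrivial pq}}

prime∤⇒coprime : ∀ {q y} → Prime q → ¬ q ∣ y → Coprime q y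
prime∤⇒coprime pq q∤y (c∣q , c∣y) with prime⇒irreducible pq c∣q
... | inj₁ c≡1 = c≡1
... | inj₂ refl = ⊥-elim (q∤y c∣y)

coprime-∣ˡ : ∀ {a b c} → Coprime a b → c ∣ a → Coprime c b
coprime-∣ˡ cab c∣a (d∣c , d∣b) = cab (∣-trans d∣c c∣a , d∣b)

coprime-∣ʳ : ∀ {a b c} → Coprime a b → c ∣ b → Coprime a c
coprime-∣ʳ cab c∣b (d∣a , d∣c) = cab (d∣a , ∣-trans d∣c c∣b)

coprime-* : ∀ {a b c} → Coprime a c → Coprime b c → Coprime (a * b) c
coprime-* {a} {b} cac cbc {d} (d∣ab , d∣c) =
  cac (coprime-divisor (Coprime.sym (coprime-∣ʳ cbc d∣c)) (subst (d ∣_) (*-comm a b) d∣ab) , d∣c)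

coprime-*-prime : ∀ {y d q} → Prime q → Coprime y (d * q) ⇔ (Coprime y d × ¬ q ∣ y)
coprime-*-prime {y} {d} {q} pq = mk⇔ split join
  where
  split : Coprime y (d * q) → Coprime y d × ¬ q ∣ y
  split c = coprime-∣ʳ c (m∣m*n q) , λ q∣y → prime⇒≢1 pq (c (q∣y , n∣m*n d))
  join : Coprime y d × ¬ q ∣ y → Coprime y (d * q)
  join (cyd , q∤y) = Coprime.sym (coprime-* (Coprime.sym cyd) (prime∤⇒coprime pq q∤y))

count-coprime-periods : ∀ g m → count (λ y → coprimeᵇ y m) (g * m) ≡ g * φ′ m
count-coprime-periods g m = count-periodic g m (λ y → coprimeᵇ y m) (coprimeᵇ-periodic m)

-- If g is coprime to m, the multiples t * g (t < m) coprime to m are those with t coprime to m.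
count-coprime-multiples : ∀ g m .{{_ : NonZero g}} → Coprime g m
                        → count (λ y → g ∣ᵇ y ∧ coprimeᵇ y m) (m * g) ≡ φ′ m
count-coprime-multiples g m cgm = trans (count-multiples m g (λ y → coprimeᵇ y m))
  (count-cong m (λ t _ → does-⇔ (coprime-*ˡ-⇔ t) (coprime? (t * g) m) (coprime? t m)))
  where
  coprime-*ˡ-⇔ : ∀ t → Coprime (t * g) m ⇔ Coprime t m
  coprime-*ˡ-⇔ t = mk⇔ drop add
    where
    drop : Coprime (t * g) m → Coprime t m
    drop c = coprime-∣ˡ c (m∣m*n g)
    add : Coprime t m → Coprime (t * g) m
    add c = coprime-* c cgm

φ′-prime-step : ∀ d q → Prime q → ¬ q ∣ d → φ′ (d * q) + φ′ d ≡ q * φ′ d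
φ′-prime-step d q pq q∤d = begin
  φ′ (d * q) + φ′ d
    ≡⟨ cong₂ _+_ coprime-to-dq (sym coprime-multiples) ⟩
  count (λ y → coprimeᵇ y d ∧ not (q ∣ᵇ y)) (d * q) + count (λ y → coprimeᵇ y d ∧ q ∣ᵇ y) (d * q)
    ≡⟨ count-split (d * q) (λ y → coprimeᵇ y d) (q ∣ᵇ_) ⟩
  count (λ y → coprimeᵇ y d) (d * q)
    ≡⟨ cong (count (λ y → coprimeᵇ y d)) (*-comm d q) ⟩
  count (λ y → coprimeᵇ y d) (q * d)
    ≡⟨ count-coprime-periods q d ⟩
  q * φ′ d ∎
  where
  open ≡-Reasoning
  instance _ = prime⇒nonZero pq
  coprime-to-dq : φ′ (d * q) ≡ count (λ y → coprimeᵇ y d ∧ not (q ∣ᵇ y)) (d * q)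
  coprime-to-dq = count-cong (d * q) (λ y _ → does-⇔ (coprime-*-prime pq) (coprime? y (d * q)) (coprime? y d ×-dec ¬? (q ∣? y)))
  coprime-multiples : count (λ y → coprimeᵇ y d ∧ q ∣ᵇ y) (d * q) ≡ φ′ d
  coprime-multiples = trans (count-cong (d * q) (λ y _ → ∧-comm (coprimeᵇ y d) (q ∣ᵇ y)))
                            (count-coprime-multiples q d (prime∤⇒coprime pq q∤d))

[k%n*a]%n≡[k*a]%n : ∀ k a n .{{_ : NonZero n}} → ((k % n) * a) % n ≡ (k * a) % n
[k%n*a]%n≡[k*a]%n k a n = begin
  ((k % n) * a) % n             ≡⟨ %-distribˡ-* (k % n) a n ⟩
  ((k % n % n) * (a % n)) % n   ≡⟨ cong (λ t → (t * (a % n)) % n) (m%n%n≡m%n k n) ⟩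
  ((k % n) * (a % n)) % n       ≡⟨ sym (%-distribˡ-* k a n) ⟩
  (k * a) % n                   ∎
  where open ≡-Reasoning

congruent⇒% : ∀ n .{{_ : NonZero n}} {x b} y z → x + y * n ≡ b + z * n → b < n → x % n ≡ b
congruent⇒% n {x} {b} y z eq b<n = begin
  x % n           ≡⟨ sym ([m+kn]%n≡m%n x y n) ⟩
  (x + y * n) % n ≡⟨ cong (_% n) eq ⟩
  (b + z * n) % n ≡⟨ [m+kn]%n≡m%n b z n ⟩
  b % n           ≡⟨ m<n⇒m%n≡m b<n ⟩
  b               ∎
  where open ≡-Reasoning

congruent⇒IsPow : ∀ m (a b : Fin (suc m)) k y z → k * toℕ a + y * suc m ≡ toℕ b + z * suc m → IsPow m a b
congruent⇒IsPow m a b k y z eq =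
  fromℕ< (m%n<n k (suc m)) ,
  (begin
    (toℕ (fromℕ< (m%n<n k (suc m))) * toℕ a) % suc m ≡⟨ cong (λ t → (t * toℕ a) % suc m) (toℕ-fromℕ< (m%n<n k (suc m))) ⟩
    ((k % suc m) * toℕ a) % suc m                    ≡⟨ [k%n*a]%n≡[k*a]%n k (toℕ a) (suc m) ⟩
    (k * toℕ a) % suc m                              ≡⟨ congruent⇒% (suc m) y z eq (toℕ<n b) ⟩
    toℕ b                                            ∎)
  where open ≡-Reasoning

-- The multiples of a in ℤ_N are the multiples of gcd(a, N): one direction because
-- gcd(a, N) divides both k * a and N, the other by Bézout's identity.
IsPow⇒gcd∣ : ∀ m (a b : Fin (suc m)) → IsPow m a b → gcd (toℕ a) (suc m) ∣ toℕ b
IsPow⇒gcd∣ m a b (k , eq) = subst (gcd (toℕ a) (suc m) ∣_) eq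
  (%-presˡ-∣ (∣n⇒∣m*n (toℕ k) (gcd[m,n]∣m (toℕ a) (suc m))) (gcd[m,n]∣n (toℕ a) (suc m)))

gcd∣⇒IsPow : ∀ m (a b : Fin (suc m)) → gcd (toℕ a) (suc m) ∣ toℕ b → IsPow m a b
gcd∣⇒IsPow m a b (divides c b≡c*g) with Bézout.identity (gcd-GCD (toℕ a) (suc m))
... | Bézout.+- x y g+yN≡xA = congruent⇒IsPow m a b (c * x) 0 (c * y) (begin
  c * x * A + 0 * N     ≡⟨ rearrange₁ c x A N ⟩
  c * (x * A)           ≡⟨ cong (c *_) (sym g+yN≡xA) ⟩
  c * (g + y * N)       ≡⟨ rearrange₂ c g y N ⟩
  c * g + c * y * N     ≡⟨ cong (_+ c * y * N) (sym b≡c*g) ⟩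
  toℕ b + c * y * N     ∎)
  where
  open ≡-Reasoning
  A N g : ℕ
  A = toℕ a
  N = suc m
  g = gcd A N
  rearrange₁ : ∀ c x A N → c * x * A + 0 * N ≡ c * (x * A)
  rearrange₁ = solve-∀
  rearrange₂ : ∀ c g y N → c * (g + y * N) ≡ c * g + c * y * N
  rearrange₂ = solve-∀
... | Bézout.-+ x y g+xA≡yN = congruent⇒IsPow m a b (c * (m * x)) (c * y) (c * (x * A)) (begin
  c * (m * x) * A + c * y * N         ≡⟨ rearrange₁ c m x A y ⟩
  c * (m * x * A) + c * (y * N)       ≡⟨ cong (λ t → c * (m * x * A) + c * t) (sym g+xA≡yN) ⟩
  c * (m * x * A) + c * (g + x * A)   ≡⟨ rearrange₂ c m x A g ⟩
  c * g + c * (x * A) * N             ≡⟨ cong (_+ c * (x * A) * N) (sym b≡c*g) ⟩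
  toℕ b + c * (x * A) * N             ∎)
  where
  open ≡-Reasoning
  A N g : ℕ
  A = toℕ a
  N = suc m
  g = gcd A N
  rearrange₁ : ∀ c m x A y → c * (m * x) * A + c * y * suc m ≡ c * (m * x * A) + c * (y * suc m)
  rearrange₁ = solve-∀
  rearrange₂ : ∀ c m x A g → c * (m * x * A) + c * (g + x * A) ≡ c * g + c * (x * A) * suc m
  rearrange₂ = solve-∀

-- Let x ∈ ℤ_N (N = suc n′) with g = gcd(x, N), and suppose N = m * g with
-- g coprime to m (as happens for squarefree N). Then y is a multiple of x iff g ∣ y, and x is a
-- multiple of y iff gcd(y, N) ∣ g iff y is coprime to m. By inclusion–exclusion the closed
-- neighbourhood of x has m + g φ(m) - φ(m) elements.
module DegreeFormula (n′ : ℕ) (x : Fin (suc n′)) (m : ℕ)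
                     (m*g≡N : m * gcd (toℕ x) (suc n′) ≡ suc n′) (coprime-g-m : Coprime (gcd (toℕ x) (suc n′)) m) where

  N g : ℕ
  N = suc n′
  g = gcd (toℕ x) N

  instance
    g≢0 : NonZero g
    g≢0 = ≢-nonZero (gcd[m,n]≢0 (toℕ x) N (inj₂ λ ()))

  m∣N : m ∣ N
  m∣N = divides g (trans (sym m*g≡N) (*-comm m g))

  IsPow⇒coprime : ∀ (y : Fin N) → IsPow n′ y x → Coprime (toℕ y) m
  IsPow⇒coprime y y↝x (c∣y , c∣m) =
    coprime-g-m (gcd-greatest (∣-trans (gcd-greatest c∣y (∣-trans c∣m m∣N)) (IsPow⇒gcd∣ n′ y x y↝x)) (∣-trans c∣m m∣N) , c∣m)

  coprime⇒IsPow : ∀ (y : Fin N) → Coprime (toℕ y) m → IsPow n′ y x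
  coprime⇒IsPow y cym = gcd∣⇒IsPow n′ y x (∣-trans gcd[y,N]∣g (gcd[m,n]∣m (toℕ x) N))
    where
    gcd[y,N]∣g : gcd (toℕ y) N ∣ g
    gcd[y,N]∣g = coprime-divisor (coprime-∣ˡ cym (gcd[m,n]∣m (toℕ y) N))
                                 (subst (gcd (toℕ y) N ∣_) (sym m*g≡N) (gcd[m,n]∣n (toℕ y) N))

  closed : ℕ → Bool
  closed y = g ∣ᵇ y ∨ coprimeᵇ y m

  adj≡ : ∀ (y : Fin N) → does (adj? n′ x y) ≡ not (does (toℕ y ≟ toℕ x)) ∧ closed (toℕ y)
  adj≡ y = cong₂ (λ u w → not u ∧ w)
    (does-⇔ (mk⇔ (λ x≡y → cong toℕ (sym x≡y)) (λ y≡x → sym (toℕ-injective y≡x))) (x ≟ᶠ y) (toℕ y ≟ toℕ x))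
    (cong₂ _∨_ (does-⇔ (mk⇔ (IsPow⇒gcd∣ n′ x y) (gcd∣⇒IsPow n′ x y)) (isPow? n′ x y) (g ∣? toℕ y))
               (does-⇔ (mk⇔ (IsPow⇒coprime y) (coprime⇒IsPow y)) (isPow? n′ y x) (coprime? (toℕ y) m)))

  -- #closed + φ m = #(multiples of g) + #(coprime to m) = m + g φ m.
  count-closed : count closed N + φ′ m ≡ m + g * φ′ m
  count-closed = +-cancelʳ-≡ (φ′ m) _ _ (begin
    count closed N + φ′ m + φ′ m
      ≡⟨ cong₂ (λ L c → count closed L + φ′ m + c) (sym m*g≡N) (sym (count-coprime-multiples g m coprime-g-m)) ⟩
    count closed (m * g) + φ′ m + both
      ≡⟨ +-swapʳ (count closed (m * g)) (φ′ m) both ⟩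
    count closed (m * g) + both + φ′ m
      ≡⟨ cong (_+ φ′ m) (count-∨-∧ (m * g) (g ∣ᵇ_) (λ y → coprimeᵇ y m)) ⟩
    count (g ∣ᵇ_) (m * g) + count (λ y → coprimeᵇ y m) (m * g) + φ′ m
      ≡⟨ cong₂ (λ u w → u + w + φ′ m) (count-multiples-all m g) (trans (cong (count (λ y → coprimeᵇ y m)) (*-comm m g)) (count-coprime-periods g m)) ⟩
    m + g * φ′ m + φ′ m ∎)
    where
    open ≡-Reasoning
    both : ℕ
    both = count (λ y → g ∣ᵇ y ∧ coprimeᵇ y m) (m * g)

  degree-formula : degFin n′ x + 1 + φ′ m ≡ m + g * φ′ m
  degree-formula = trans (cong (_+ φ′ m) closed-neighbourhood) count-closed
    where
    closed-neighbourhood : degFin n′ x + 1 ≡ count closed N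
    closed-neighbourhood = trans
      (cong (_+ 1) (length-filter-tabulate N (λ k → k) (adj? n′ x) (λ y → not (does (y ≟ toℕ x)) ∧ closed y) adj≡))
      (count-remove N (toℕ x) closed (toℕ<n x) (cong (_∨ coprimeᵇ (toℕ x) m) (dec-true (g ∣? toℕ x) (gcd[m,n]∣m (toℕ x) N))))

open DegreeFormula using (degree-formula)

-- Splittings of the primes p 1, …, p k into a left and a right part.  Split p k u a v b
-- records the products u, v of the two parts and the products a, b of the p i - 1 over
-- them, so that (for distinct primes) a = φ u and b = φ v.  For N = p 1 ⋯ p r, a vertex x of
-- P(C_N) is described by the splitting with v = gcd(x, N) and u = N / v.
data Split (p : ℕ → ℕ) : ℕ → ℕ → ℕ → ℕ → ℕ → Set where
  none  : Split p 0 1 1 1 1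
  left  : ∀ {k u a v b} → Split p k u a v b → Split p (suc k) (u * p (suc k)) (a * (p (suc k) ∸ 1)) v b
  right : ∀ {k u a v b} → Split p k u a v b → Split p (suc k) u a (v * p (suc k)) (b * (p (suc k) ∸ 1))

prime⇒≥2 : ∀ {q} → Prime q → 2 ≤ q
prime⇒≥2 {q} pq = nonTrivial⇒n>1 q {{prime⇒nonTrivial pq}}

module Splittings (p : ℕ → ℕ) (K : ℕ)
  (prime : ∀ i → 1 ≤ i → i ≤ K → Prime (p i))
  (increasing : ∀ i j → 1 ≤ i → i < j → j ≤ K → p i < p j) where

  Πp : ℕ → ℕ
  Πp = prodUpTo p

  Φp : ℕ → ℕ
  Φp = prodUpTo (λ i → p i ∸ 1)

  p≥2 : ∀ i → 1 ≤ i → i ≤ K → 2 ≤ p i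
  p≥2 i 1≤i i≤K = prime⇒≥2 (prime i 1≤i i≤K)

  1≤p : ∀ i → 1 ≤ i → i ≤ K → 1 ≤ p i
  1≤p i 1≤i i≤K = ≤-trans (n≤1+n 1) (p≥2 i 1≤i i≤K)

  1≤p∸1 : ∀ i → 1 ≤ i → i ≤ K → 1 ≤ p i ∸ 1
  1≤p∸1 i 1≤i i≤K = ∸-monoˡ-≤ 1 (p≥2 i 1≤i i≤K)

  p≥1+i : ∀ i → 1 ≤ i → i ≤ K → suc i ≤ p i
  p≥1+i 1 _ 1≤K = p≥2 1 ≤-refl 1≤K
  p≥1+i (suc (suc i)) _ i+2≤K =
    ≤-trans (s≤s (p≥1+i (suc i) (s≤s z≤n) (≤-trans (n≤1+n _) i+2≤K))) (increasing (suc i) (suc (suc i)) (s≤s z≤n) ≤-refl i+2≤K)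

  Split-∏ : ∀ {k u a v b} → Split p k u a v b → u * v ≡ Πp k
  Split-∏ none = refl
  Split-∏ {suc k} (left {u = u} {v = v} s) = trans (*-swapʳ u (p (suc k)) v) (cong (_* p (suc k)) (Split-∏ s))
  Split-∏ {suc k} (right {u = u} {v = v} s) = trans (sym (*-assoc u v _)) (cong (_* p (suc k)) (Split-∏ s))

  Split-Φ : ∀ {k u a v b} → Split p k u a v b → a * b ≡ Φp k
  Split-Φ none = refl
  Split-Φ {suc k} (left {a = a} {b = b} s) = trans (*-swapʳ a (p (suc k) ∸ 1) b) (cong (_* (p (suc k) ∸ 1)) (Split-Φ s))
  Split-Φ {suc k} (right {a = a} {b = b} s) = trans (sym (*-assoc a b _)) (cong (_* (p (suc k) ∸ 1)) (Split-Φ s))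

  Split-pos : ∀ {k u a v b} → k ≤ K → Split p k u a v b → (1 ≤ u × 1 ≤ a) × (1 ≤ v × 1 ≤ b)
  Split-pos _ none = (s≤s z≤n , s≤s z≤n) , (s≤s z≤n , s≤s z≤n)
  Split-pos {suc k} k≤K (left s) with Split-pos (≤-trans (n≤1+n k) k≤K) s
  ... | (1≤u , 1≤a) , right-pos = (*-mono-≤ 1≤u (1≤p (suc k) (s≤s z≤n) k≤K) , *-mono-≤ 1≤a (1≤p∸1 (suc k) (s≤s z≤n) k≤K)) , right-pos
  Split-pos {suc k} k≤K (right s) with Split-pos (≤-trans (n≤1+n k) k≤K) s
  ... | left-pos , (1≤v , 1≤b) = left-pos , (*-mono-≤ 1≤v (1≤p (suc k) (s≤s z≤n) k≤K) , *-mono-≤ 1≤b (1≤p∸1 (suc k) (s≤s z≤n) k≤K))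

  left-Φ≤ : ∀ {k u a v b} → Split p k u a v b → a ≤ u
  left-Φ≤ none = ≤-refl
  left-Φ≤ {suc k} (left s) = *-mono-≤ (left-Φ≤ s) (m∸n≤m (p (suc k)) 1)
  left-Φ≤ (right s) = left-Φ≤ s

  right-Φ≤ : ∀ {k u a v b} → Split p k u a v b → b ≤ v
  right-Φ≤ none = ≤-refl
  right-Φ≤ (left s) = right-Φ≤ s
  right-Φ≤ {suc k} (right s) = *-mono-≤ (right-Φ≤ s) (m∸n≤m (p (suc k)) 1)

  p∤Πp : ∀ j k → k < j → j ≤ K → ¬ p j ∣ Πp k
  p∤Πp j zero 0<j j≤K pj∣1 = prime⇒≢1 (prime j 0<j j≤K) (∣1⇒≡1 pj∣1)
  p∤Πp j (suc k) k<j j≤K pj∣Πp with euclidsLemma (Πp k) (p (suc k)) (prime j (≤-trans (s≤s z≤n) k<j) j≤K) pj∣Πp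
  ... | inj₁ pj∣Πk = p∤Πp j k (≤-trans (n≤1+n _) k<j) j≤K pj∣Πk
  ... | inj₂ pj∣pk with prime⇒irreducible (prime (suc k) (s≤s z≤n) (≤-trans (n≤1+n _) (≤-trans k<j j≤K))) pj∣pk
  ...   | inj₁ pj≡1 = prime⇒≢1 (prime j (≤-trans (s≤s z≤n) k<j) j≤K) pj≡1
  ...   | inj₂ pj≡pk = <-irrefl (sym pj≡pk) (increasing (suc k) j (s≤s z≤n) k<j j≤K)

  left∣Πp : ∀ {k u a v b} → Split p k u a v b → u ∣ Πp k
  left∣Πp {v = v} s = divides v (trans (sym (Split-∏ s)) (*-comm _ v))

  right∣Πp : ∀ {k u a v b} → Split p k u a v b → v ∣ Πp k
  right∣Πp {u = u} s = divides u (sym (Split-∏ s))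

  left-φ′ : ∀ {k u a v b} → k ≤ K → Split p k u a v b → φ′ u ≡ a
  left-φ′ _ none = refl
  left-φ′ {suc k} k≤K (right s) = left-φ′ (≤-trans (n≤1+n k) k≤K) s
  left-φ′ {suc k} k≤K (left {u = u} {a = a} s) = +-cancelʳ-≡ a _ _ (begin
    φ′ (u * q) + a      ≡⟨ cong (φ′ (u * q) +_) (sym ih) ⟩
    φ′ (u * q) + φ′ u   ≡⟨ φ′-prime-step u q pq (λ q∣u → p∤Πp (suc k) k ≤-refl k≤K (∣-trans q∣u (left∣Πp s))) ⟩
    q * φ′ u            ≡⟨ cong (q *_) ih ⟩
    q * a               ≡⟨ *-comm q a ⟩
    a * q               ≡⟨ cong (a *_) (sym (m∸n+n≡m 1≤q)) ⟩
    a * (q ∸ 1 + 1)     ≡⟨ *-distribˡ-+ a (q ∸ 1) 1 ⟩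
    a * (q ∸ 1) + a * 1 ≡⟨ cong (a * (q ∸ 1) +_) (*-identityʳ a) ⟩
    a * (q ∸ 1) + a     ∎)
    where
    open ≡-Reasoning
    q : ℕ
    q = p (suc k)
    pq : Prime q
    pq = prime (suc k) (s≤s z≤n) k≤K
    1≤q : 1 ≤ q
    1≤q = 1≤p (suc k) (s≤s z≤n) k≤K
    ih : φ′ u ≡ a
    ih = left-φ′ (≤-trans (n≤1+n k) k≤K) s

  left-right-coprime : ∀ {k u a v b} → k ≤ K → Split p k u a v b → Coprime u v
  left-right-coprime _ none = Coprime.1-coprimeTo 1
  left-right-coprime {suc k} k≤K (left s) =
    coprime-* (left-right-coprime (≤-trans (n≤1+n k) k≤K) s)
              (prime∤⇒coprime (prime (suc k) (s≤s z≤n) k≤K) (λ q∣v → p∤Πp (suc k) k ≤-refl k≤K (∣-trans q∣v (right∣Πp s))))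
  left-right-coprime {suc k} k≤K (right s) = Coprime.sym
    (coprime-* (Coprime.sym (left-right-coprime (≤-trans (n≤1+n k) k≤K) s))
               (prime∤⇒coprime (prime (suc k) (s≤s z≤n) k≤K) (λ q∣u → p∤Πp (suc k) k ≤-refl k≤K (∣-trans q∣u (left∣Πp s)))))

  divisor⇒Split : ∀ k → k ≤ K → ∀ d → d ∣ Πp k → Σ ℕ λ u → Σ ℕ λ a → Σ ℕ λ b → Split p k u a d b
  divisor⇒Split zero _ d d∣1 rewrite ∣1⇒≡1 d∣1 = 1 , 1 , 1 , none
  divisor⇒Split (suc k) k+1≤K d d∣Πp with p (suc k) ∣? d | prime (suc k) (s≤s z≤n) k+1≤K
  ... | no q∤d | pq =
    let (u , a , b , s) = divisor⇒Split k (≤-trans (n≤1+n k) k+1≤K) d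
                            (coprime-divisor (Coprime.sym (prime∤⇒coprime pq q∤d)) (subst (d ∣_) (*-comm (Πp k) (p (suc k))) d∣Πp))
    in _ , _ , _ , left s
  ... | yes (divides d′ d≡d′q) | pq rewrite d≡d′q =
    let instance _ = prime⇒nonZero pq
        (u , a , b , s) = divisor⇒Split k (≤-trans (n≤1+n k) k+1≤K) d′ (*-cancelʳ-∣ (p (suc k)) d∣Πp)
    in _ , _ , _ , right s

  -- u / φ(u) < p (k + 1) for the left part u of a splitting of the first k primes:
  -- each factor p i / (p i - 1) is at most p i ≤ p (i + 1) - 1, and the product telescopes.
  left-bound : ∀ {k u a v b} → suc k ≤ K → Split p k u a v b → u ≤ (p (suc k) ∸ 1) * a
  left-bound k+1≤K none = subst (1 ≤_) (sym (*-identityʳ _)) (1≤p∸1 1 ≤-refl k+1≤K)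
  left-bound {suc k} k+2≤K (right {a = a} s) =
    ≤-trans (left-bound (≤-trans (n≤1+n _) k+2≤K) s) (*-monoˡ-≤ a (∸-monoˡ-≤ 1 (<⇒≤ q<q′)))
    where
    q<q′ : p (suc k) < p (suc (suc k))
    q<q′ = increasing (suc k) (suc (suc k)) (s≤s z≤n) ≤-refl k+2≤K
  left-bound {suc k} k+2≤K (left {u = u} {a = a} s) = begin
    u * q                   ≤⟨ *-monoˡ-≤ q (left-bound (≤-trans (n≤1+n _) k+2≤K) s) ⟩
    (q ∸ 1) * a * q         ≡⟨ rearrange (q ∸ 1) a q ⟩
    q * (a * (q ∸ 1))       ≤⟨ *-monoˡ-≤ (a * (q ∸ 1)) (∸-monoˡ-≤ 1 q<q′) ⟩
    (q′ ∸ 1) * (a * (q ∸ 1)) ∎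
    where
    open ≤-Reasoning
    q q′ : ℕ
    q = p (suc k)
    q′ = p (suc (suc k))
    q<q′ : q < q′
    q<q′ = increasing (suc k) (suc (suc k)) (s≤s z≤n) ≤-refl k+2≤K
    rearrange : ∀ x a q → x * a * q ≡ q * (a * x)
    rearrange = solve-∀

  -- For c bounding all of p 1, …, p k, the right part v satisfies v - 1 ≤ c (v - φ(v)):
  -- adding a prime q ≤ c multiplies both sides by q and costs at most q - 1 ≤ c φ(v).
  right-bound : ∀ {k u a v b} c → k ≤ K → (∀ i → 1 ≤ i → i ≤ k → p i ≤ c) → Split p k u a v b → v + c * b ≤ c * v + 1
  right-bound c _ _ none = ≤-reflexive (+-comm 1 (c * 1))
  right-bound {suc k} c k≤K p≤c (left s) = right-bound c (≤-trans (n≤1+n _) k≤K) (λ i 1≤i i≤k → p≤c i 1≤i (≤-trans i≤k (n≤1+n _))) s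
  right-bound {suc k} c k≤K p≤c (right {v = v} {b = b} s)
    with p (suc k) | p≥2 (suc k) (s≤s z≤n) k≤K | p≤c (suc k) (s≤s z≤n) ≤-refl | Split-pos (≤-trans (n≤1+n _) k≤K) s
  ... | suc q′ | _ | q≤c | _ , (_ , 1≤b) = +-cancelʳ-≤ (c * b) _ _ (begin
    v * suc q′ + c * (b * q′) + c * b   ≡⟨ expandˡ v c b q′ ⟩
    (v + c * b) * suc q′                ≤⟨ *-monoˡ-≤ (suc q′) ih ⟩
    (c * v + 1) * suc q′                ≡⟨ expandʳ v c q′ ⟩
    c * (v * suc q′) + 1 + q′           ≤⟨ +-monoʳ-≤ (c * (v * suc q′) + 1) q′≤cb ⟩
    c * (v * suc q′) + 1 + c * b        ∎)
    where
    open ≤-Reasoning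
    ih : v + c * b ≤ c * v + 1
    ih = right-bound c (≤-trans (n≤1+n _) k≤K) (λ i 1≤i i≤k → p≤c i 1≤i (≤-trans i≤k (n≤1+n _))) s
    q′≤cb : q′ ≤ c * b
    q′≤cb = ≤-trans (n≤1+n q′) (≤-trans q≤c (subst (_≤ c * b) (*-identityʳ c) (*-monoʳ-≤ c 1≤b)))
    expandˡ : ∀ v c b q′ → v * suc q′ + c * (b * q′) + c * b ≡ (v + c * b) * suc q′
    expandˡ = solve-∀
    expandʳ : ∀ v c q′ → (c * v + 1) * suc q′ ≡ c * (v * suc q′) + 1 + q′
    expandʳ = solve-∀

  move-left : ∀ {k u a v b} → Split p k u a v b → 2 ≤ v
            → Σ ℕ λ i → Σ ℕ λ v′ → Σ ℕ λ b′ → (1 ≤ i × i ≤ k) × v ≡ v′ * p i × Split p k (u * p i) (a * (p i ∸ 1)) v′ b′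
  move-left none (s≤s ())
  move-left {suc k} (right {v = v} {b = b} s) _ = suc k , v , b , (s≤s z≤n , ≤-refl) , refl , left s
  move-left {suc k} (left {u = u} {a = a} s) 2≤v with move-left s 2≤v
  ... | i , v′ , b′ , (1≤i , i≤k) , v≡v′pi , s′ =
    i , v′ , b′ , (1≤i , ≤-trans i≤k (n≤1+n k)) , v≡v′pi ,
    subst₂ (λ u′ a′ → Split p (suc k) u′ a′ v′ b′) (*-swapʳ u (p i) (p (suc k))) (*-swapʳ a (p i ∸ 1) (p (suc k) ∸ 1)) (left s′)

  -- P / φ(P) ≤ j + 1 for P = p 1 ⋯ p j, since p i / (p i - 1) ≤ (i + 1) / i and the product telescopes.
  Πp≤[1+j]Φp : ∀ j → j ≤ K → Πp j ≤ suc j * Φp j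
  Πp≤[1+j]Φp zero _ = ≤-refl
  Πp≤[1+j]Φp (suc j) j+1≤K with p (suc j) | p≥1+i (suc j) (s≤s z≤n) j+1≤K
  ... | suc q′ | s≤s j+1≤q′ = begin
    Πp j * suc q′                 ≤⟨ *-monoˡ-≤ (suc q′) (Πp≤[1+j]Φp j (≤-trans (n≤1+n j) j+1≤K)) ⟩
    suc j * Φp j * suc q′         ≡⟨ regroup₁ j (Φp j) q′ ⟩
    Φp j * (suc j + suc j * q′)   ≤⟨ *-monoʳ-≤ (Φp j) (+-monoˡ-≤ (suc j * q′) j+1≤q′) ⟩
    Φp j * (q′ + suc j * q′)      ≡⟨ regroup₂ j (Φp j) q′ ⟩
    suc (suc j) * (Φp j * q′)     ∎
    where
    open ≤-Reasoning
    regroup₁ : ∀ j F q′ → suc j * F * suc q′ ≡ F * (suc j + suc j * q′)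
    regroup₁ = solve-∀
    regroup₂ : ∀ j F q′ → F * (q′ + suc j * q′) ≡ suc (suc j) * (F * q′)
    regroup₂ = solve-∀

  all-left : ∀ k → Split p k (Πp k) (Φp k) 1 1
  all-left zero = none
  all-left (suc k) = left (all-left k)

  2≤Πp : ∀ j → 1 ≤ j → j ≤ K → 2 ≤ Πp j
  2≤Πp (suc j) _ j+1≤K =
    *-mono-≤ (proj₁ (proj₁ (Split-pos (≤-trans (n≤1+n j) j+1≤K) (all-left j)))) (p≥2 (suc j) (s≤s z≤n) j+1≤K)

-- A profile (m , g , a) describes a vertex with gcd(x, N) = g, cofactor m = N / g and a = φ(m);
-- by the degree formula its degree is m + (g - 1) a - 1.  Profiles are compared by this cost,
-- stated without truncated subtraction: c₁ ≼ c₂ iff m₁ + (g₁ - 1) a₁ ≤ m₂ + (g₂ - 1) a₂.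
Profile : Set
Profile = ℕ × ℕ × ℕ

weight : Profile → ℕ
weight (m , g , a) = m + g * a

φpart : Profile → ℕ
φpart (m , g , a) = a

record _≼_ (c₁ c₂ : Profile) : Set where
  constructor mk≼
  field ≼⇒≤ : weight c₁ + φpart c₂ ≤ weight c₂ + φpart c₁

≼-reflexive : ∀ {c₁ c₂} → c₁ ≡ c₂ → c₁ ≼ c₂
≼-reflexive refl = mk≼ ≤-refl

≼-trans : ∀ {c₁ c₂ c₃} → c₁ ≼ c₂ → c₂ ≼ c₃ → c₁ ≼ c₃
≼-trans {c₁} {c₂} {c₃} (mk≼ le₁₂) (mk≼ le₂₃) = mk≼ (+-cancelʳ-≤ a₂ _ _ (begin
  w₁ + a₃ + a₂   ≡⟨ +-swapʳ w₁ a₃ a₂ ⟩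
  w₁ + a₂ + a₃   ≤⟨ +-monoˡ-≤ a₃ le₁₂ ⟩
  w₂ + a₁ + a₃   ≡⟨ +-swapʳ w₂ a₁ a₃ ⟩
  w₂ + a₃ + a₁   ≤⟨ +-monoˡ-≤ a₁ le₂₃ ⟩
  w₃ + a₂ + a₁   ≡⟨ +-swapʳ w₃ a₂ a₁ ⟩
  w₃ + a₁ + a₂   ∎))
  where
  open ≤-Reasoning
  w₁ w₂ w₃ a₁ a₂ a₃ : ℕ
  w₁ = weight c₁ ; w₂ = weight c₂ ; w₃ = weight c₃
  a₁ = φpart c₁ ; a₂ = φpart c₂ ; a₃ = φpart c₃

-- Exchanging a prime x on the left with a larger prime y on the right does not lower the cost:
-- the small primes belong in the cofactor.
exchange : ∀ U V a x y → 1 ≤ x → x ≤ y → 1 ≤ V → (U * x , V * y , a * (x ∸ 1)) ≼ (U * y , V * x , a * (y ∸ 1))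
exchange U (suc V′) a (suc x′) y _ x≤y _ with m≤n⇒∃[o]m+o≡n x≤y
... | e , refl = mk≼ (≤-trans (m≤m+n _ (e * (U + a * V′))) (≤-reflexive (sym (expand U V′ a x′ e))))
  where
  expand : ∀ U V′ a x′ e → (U * (suc x′ + e) + suc V′ * suc x′ * (a * (x′ + e))) + a * x′
         ≡ ((U * suc x′ + suc V′ * (suc x′ + e) * (a * x′)) + a * (x′ + e)) + e * (U + a * V′)
  expand = solve-∀

-- With (u, a) and (v, b) the left and right parts of a splitting of the smaller primes, the
-- bounds u ≤ (Q - 1) a and v - 1 ≤ Q (v - b) show that the vertex Q R is at least as cheap.
both-right-estimate : ∀ u a v b Q R → u ≤ (Q ∸ 1) * a → v + Q * b ≤ Q * v + 1 → 1 ≤ b → b ≤ v → Q ≤ R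
                    → (u * v , Q * R , a * b) ≼ (u , v * Q * R , a)
both-right-estimate u a v b@(suc b′) Q R u≤[Q-1]a v-bound _ b≤v Q≤R with m≤n⇒∃[o]m+o≡n b≤v
... | w , refl = mk≼ (begin
  u * (suc b′ + w) + Q * R * (a * suc b′) + a ≡⟨ regroupˡ u a b′ w Q R ⟩
  base + u * (b′ + w)                         ≤⟨ +-monoʳ-≤ base key ⟩
  base + (Q * R * a * w + a * b′)             ≡⟨ regroupʳ u a b′ w Q R ⟩
  u + (suc b′ + w) * Q * R * a + a * suc b′   ∎)
  where
  open ≤-Reasoning
  base : ℕ
  base = u + Q * R * a * suc b′ + a
  regroupˡ : ∀ u a b′ w Q R → u * (suc b′ + w) + Q * R * (a * suc b′) + a ≡ (u + Q * R * a * suc b′ + a) + u * (b′ + w)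
  regroupˡ = solve-∀
  regroupʳ : ∀ u a b′ w Q R → (u + Q * R * a * suc b′ + a) + (Q * R * a * w + a * b′) ≡ u + (suc b′ + w) * Q * R * a + a * suc b′
  regroupʳ = solve-∀
  -- v - 1 ≤ Q (v - b), i.e. b′ + w ≤ Q w
  v-bound′ : b′ + w ≤ Q * w
  v-bound′ = +-cancelˡ-≤ (1 + Q + Q * b′) _ _ (begin
    1 + Q + Q * b′ + (b′ + w) ≡⟨ regroup₁ b′ w Q ⟩
    suc b′ + w + Q * suc b′   ≤⟨ v-bound ⟩
    Q * (suc b′ + w) + 1      ≡⟨ regroup₂ b′ w Q ⟩
    1 + Q + Q * b′ + Q * w    ∎)
    where
    regroup₁ : ∀ b′ w Q → 1 + Q + Q * b′ + (b′ + w) ≡ suc b′ + w + Q * suc b′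
    regroup₁ = solve-∀
    regroup₂ : ∀ b′ w Q → Q * (suc b′ + w) + 1 ≡ 1 + Q + Q * b′ + Q * w
    regroup₂ = solve-∀
  -- the heart of the estimate: u (v - 1) ≤ (Q - 1) a · Q (v - b) ≤ Q R a (v - b)
  key : u * (b′ + w) ≤ Q * R * a * w + a * b′
  key = begin
    u * (b′ + w)            ≤⟨ *-mono-≤ u≤[Q-1]a v-bound′ ⟩
    (Q ∸ 1) * a * (Q * w)   ≤⟨ *-monoˡ-≤ (Q * w) (*-monoˡ-≤ a (≤-trans (m∸n≤m Q 1) Q≤R)) ⟩
    R * a * (Q * w)         ≡⟨ regroup R a Q w ⟩
    Q * R * a * w           ≤⟨ m≤m+n _ _ ⟩
    Q * R * a * w + a * b′  ∎
    where
    regroup : ∀ R a Q w → R * a * (Q * w) ≡ Q * R * a * w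
    regroup = solve-∀

-- A generator (gcd 1, every prime in the cofactor) is no cheaper than the vertex R.
all-left-estimate : ∀ P Φ Q R → 1 ≤ R → Φ ≤ P → (P * Q , R , Φ * (Q ∸ 1)) ≼ (P * Q * R , 1 , Φ * (Q ∸ 1) * (R ∸ 1))
all-left-estimate P Φ Q (suc r) _ Φ≤P = mk≼ (begin
  P * Q + suc r * (Φ * q) + Φ * q * r         ≡⟨ regroupˡ P Φ Q r q ⟩
  (P * Q + Φ * q * r + Φ * q) + r * (Φ * q)   ≤⟨ +-monoʳ-≤ (P * Q + Φ * q * r + Φ * q) (*-monoʳ-≤ r (*-mono-≤ Φ≤P (m∸n≤m Q 1))) ⟩
  (P * Q + Φ * q * r + Φ * q) + r * (P * Q)   ≡⟨ regroupʳ P Φ Q r q ⟩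
  P * Q * suc r + 1 * (Φ * q * r) + Φ * q     ∎)
  where
  open ≤-Reasoning
  q : ℕ
  q = Q ∸ 1
  regroupˡ : ∀ P Φ Q r q → P * Q + suc r * (Φ * q) + Φ * q * r ≡ (P * Q + Φ * q * r + Φ * q) + r * (Φ * q)
  regroupˡ = solve-∀
  regroupʳ : ∀ P Φ Q r q → (P * Q + Φ * q * r + Φ * q) + r * (P * Q) ≡ P * Q * suc r + 1 * (Φ * q * r) + Φ * q
  regroupʳ = solve-∀

-- Cases on the sides of Q and R: with both on the right use both-right-estimate;
-- otherwise move the primes of the right part across one at a time with exchange.
module Minimum (p : ℕ → ℕ) (k : ℕ)
  (prime : ∀ i → 1 ≤ i → i ≤ suc (suc k) → Prime (p i))
  (increasing : ∀ i j → 1 ≤ i → i < j → j ≤ suc (suc k) → p i < p j) where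

  open Splittings p (suc (suc k)) prime increasing

  P Φ Q R : ℕ
  P = Πp k
  Φ = Φp k
  Q = p (suc k)
  R = p (suc (suc k))

  profileR : Profile
  profileR = (P * Q , R , Φ * (Q ∸ 1))

  profileQR : Profile
  profileQR = (P , Q * R , Φ)

  Dominated : Profile → Set
  Dominated c = (profileR ≼ c) ⊎ (profileQR ≼ c)

  dominated-≼ : ∀ {c₁ c₂} → Dominated c₁ → c₁ ≼ c₂ → Dominated c₂
  dominated-≼ d c₁≼c₂ = map⊎ (λ h → ≼-trans h c₁≼c₂) (λ h → ≼-trans h c₁≼c₂) d

  k≤K : k ≤ suc (suc k)
  k≤K = ≤-trans (n≤1+n k) (n≤1+n (suc k))

  Q≤R : Q ≤ R
  Q≤R = <⇒≤ (increasing (suc k) (suc (suc k)) (s≤s z≤n) ≤-refl ≤-refl)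

  p<Q : ∀ i → 1 ≤ i → i ≤ k → p i < Q
  p<Q i 1≤i i≤k = increasing i (suc k) 1≤i (s≤s i≤k) (n≤1+n (suc k))

  trivial-right : ∀ {u a v b} → Split p k u a v b → ¬ 2 ≤ v → (v ≡ 1 × b ≡ 1) × (u ≡ P × a ≡ Φ)
  trivial-right {u} {a} {v} {b} s v≱2 = (v≡1 , b≡1) , (cancel v≡1 (Split-∏ s) , cancel b≡1 (Split-Φ s))
    where
    v≤1 : v ≤ 1
    v≤1 = s≤s⁻¹ (≰⇒> v≱2)
    v≡1 : v ≡ 1
    v≡1 = ≤-antisym v≤1 (proj₁ (proj₂ (Split-pos k≤K s)))
    b≡1 : b ≡ 1
    b≡1 = ≤-antisym (≤-trans (right-Φ≤ s) v≤1) (proj₂ (proj₂ (Split-pos k≤K s)))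
    cancel : ∀ {x y z} → y ≡ 1 → x * y ≡ z → x ≡ z
    cancel {x} refl x*1≡z = trans (sym (*-identityʳ x)) x*1≡z

  both-right : ∀ {u a v b} → Split p k u a v b → profileQR ≼ (u , v * Q * R , a)
  both-right {u} {a} {v} {b} s rewrite sym (Split-∏ s) | sym (Split-Φ s) =
    both-right-estimate u a v b Q R (left-bound (n≤1+n (suc k)) s)
      (right-bound Q k≤K (λ i 1≤i i≤k → <⇒≤ (p<Q i 1≤i i≤k)) s) (proj₂ (proj₂ (Split-pos k≤K s))) (right-Φ≤ s) Q≤R

  -- Q on the left, R on the right: this is the vertex R itself when nothing else is on the
  -- right; otherwise exchange a small right prime p i with Q and use both-right.
  Q-left-R-right : ∀ {u a v b} → Split p k u a v b → Dominated (u * Q , v * R , a * (Q ∸ 1))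
  Q-left-R-right {v = v} s with 2 ≤? v
  ... | no v<2 with trivial-right s v<2
  ...   | (refl , refl) , (refl , refl) = inj₁ (≼-reflexive (cong (λ g → (P * Q , g , Φ * (Q ∸ 1))) (sym (*-identityˡ R))))
  Q-left-R-right {u} {a} s | yes 2≤v with move-left s 2≤v
  ... | i , v′ , b′ , (1≤i , i≤k) , refl , s′ = inj₂ (≼-trans (both-right s′) (≼-trans
        (≼-reflexive (cong (λ g → (u * p i , g , a * (p i ∸ 1))) (*-swapʳ v′ Q R)))
        (≼-trans (exchange u (v′ * R) a (p i) Q (1≤p i 1≤i (≤-trans i≤k k≤K)) (<⇒≤ (p<Q i 1≤i i≤k))
                           (*-mono-≤ (proj₁ (proj₂ (Split-pos k≤K s′))) (1≤p (suc (suc k)) (s≤s z≤n) ≤-refl)))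
                 (≼-reflexive (cong (λ g → (u * Q , g , a * (Q ∸ 1))) (*-swapʳ v′ R (p i)))))))

  -- R on the left, Q on the right: exchanging them gives the previous case.
  R-left-Q-right : ∀ {u a v b} → Split p k u a v b → Dominated (u * R , v * Q , a * (R ∸ 1))
  R-left-Q-right {u} {a} {v} s = dominated-≼ (Q-left-R-right s)
    (exchange u v a Q R (1≤p (suc k) (s≤s z≤n) (n≤1+n _)) Q≤R (proj₁ (proj₂ (Split-pos k≤K s))))

  -- Q and R both on the left: a generator is dominated by the vertex R; otherwise exchange a
  -- small right prime p i with R and use Q-left-R-right.
  both-left : ∀ {u a v b} → Split p k u a v b → Dominated (u * Q * R , v , a * (Q ∸ 1) * (R ∸ 1))
  both-left {v = v} s with 2 ≤? v
  ... | no v<2 with trivial-right s v<2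
  ...   | (refl , refl) , (refl , refl) = inj₁ (all-left-estimate P Φ Q R (1≤p (suc (suc k)) (s≤s z≤n) ≤-refl) (left-Φ≤ (all-left k)))
  both-left {u} {a} s | yes 2≤v with move-left s 2≤v
  ... | i , v′ , b′ , (1≤i , i≤k) , refl , s′ = dominated-≼ (Q-left-R-right s′) (≼-trans
        (≼-reflexive (cong₂ (λ m φm → (m , v′ * R , φm)) (*-swapʳ u (p i) Q) (*-swapʳ a (p i ∸ 1) (Q ∸ 1))))
        (exchange (u * Q) v′ (a * (Q ∸ 1)) (p i) R (1≤p i 1≤i (≤-trans i≤k k≤K))
                  (<⇒≤ (increasing i (suc (suc k)) 1≤i (s≤s (≤-trans i≤k (n≤1+n k))) ≤-refl)) (proj₁ (proj₂ (Split-pos k≤K s′)))))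

  dominated : ∀ {u a v b} → Split p (suc (suc k)) u a v b → Dominated (u , v , a)
  dominated (left (left s))   = both-left s
  dominated (right (left s))  = Q-left-R-right s
  dominated (left (right s))  = R-left-Q-right s
  dominated (right (right s)) = inj₂ (both-right s)

module RationalCondition where
  open import Data.Integer as ℤ using (ℤ; +_)
  import Data.Integer.Properties as ℤ
  import Data.Integer.Tactic.RingSolver as ℤ-Solver
  import Data.Rational as ℚ
  open import Data.Rational.Properties using (toℚᵘ-mono-≤; toℚᵘ-cancel-≤; toℚᵘ-homo-*; toℚᵘ-homo-+; toℚᵘ-homo‿-; toℚᵘ-fromℚᵘ)
  open import Data.Rational.Unnormalised as ℚᵘ using (ℚᵘ; mkℚᵘ; *≤*)
  import Data.Rational.Unnormalised.Properties as ℚᵘ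

  lhsᵘ : ℕ → ℕ → ℕ → ℚᵘ
  lhsᵘ P F′ q = (mkℚᵘ (+ P) F′ ℚᵘ.- ℚᵘ.1ℚᵘ) ℚᵘ.* mkℚᵘ (+ q) 0

  lhs≃lhsᵘ : ∀ P F′ q → ℚ.toℚᵘ ((P ÷ℕ suc F′ - 1ℚ) *ℚ (q ÷ℕ 1)) ℚᵘ.≃ lhsᵘ P F′ q
  lhs≃lhsᵘ P F′ q = ℚᵘ.≃-trans (toℚᵘ-homo-* (P ÷ℕ suc F′ - 1ℚ) (q ÷ℕ 1))
    (ℚᵘ.*-cong (ℚᵘ.≃-trans (toℚᵘ-homo-+ (P ÷ℕ suc F′) (ℚ.- 1ℚ)) (ℚᵘ.+-cong (toℚᵘ-fromℚᵘ (mkℚᵘ (+ P) F′)) (toℚᵘ-homo‿- 1ℚ)))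
               (toℚᵘ-fromℚᵘ (mkℚᵘ (+ q) 0)))

  -- The numerator of lhsᵘ plus F q is P q (ring identity in ℤ).
  cross-multiplied : ∀ x f z → ((x ℤ.* + 1 ℤ.+ ℤ.- (+ 1) ℤ.* f) ℤ.* z) ℤ.* + 1 ℤ.+ f ℤ.* z ≡ x ℤ.* z
  cross-multiplied = ℤ-Solver.solve-∀

  +-cancelʳ-≤ℤ : ∀ a b c → a ℤ.+ c ℤ.≤ b ℤ.+ c → a ℤ.≤ b
  +-cancelʳ-≤ℤ a b c a+c≤b+c = subst₂ ℤ._≤_ (cancel a c) (cancel b c) (ℤ.+-monoˡ-≤ (ℤ.- c) a+c≤b+c)
    where
    cancel : ∀ a c → (a ℤ.+ c) ℤ.+ ℤ.- c ≡ a
    cancel = ℤ-Solver.solve-∀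

  condition⇔ : ∀ P F q r → 1 ≤ F → ((P ÷ℕ F - 1ℚ) *ℚ (q ÷ℕ 1) ≤ℚ (r ÷ℕ 1)) ⇔ (P * q ≤ F * r + F * q)
  condition⇔ P F@(suc F′) q r _ = mk⇔ to from
    where
    -- the integer inequality behind lhsᵘ ≤ r, shifted by F q
    lhsℤ rhsℤ : ℤ
    lhsℤ = ((+ P ℤ.* + 1 ℤ.+ ℤ.- (+ 1) ℤ.* + F) ℤ.* + q) ℤ.* + 1
    rhsℤ = + r ℤ.* + (F * 1 * 1)
    lhsℤ+Fq : lhsℤ ℤ.+ + (F * q) ≡ + (P * q)
    lhsℤ+Fq = trans (cong (λ t → lhsℤ ℤ.+ t) (ℤ.pos-* F q)) (trans (cross-multiplied (+ P) (+ F) (+ q)) (sym (ℤ.pos-* P q)))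
    rhsℤ+Fq : rhsℤ ℤ.+ + (F * q) ≡ + (F * r + F * q)
    rhsℤ+Fq = trans (cong (λ t → t ℤ.+ + (F * q)) (trans (sym (ℤ.pos-* r (F * 1 * 1)))
                      (cong +_ (trans (cong (r *_) (trans (*-identityʳ _) (*-identityʳ F))) (*-comm r F)))))
                    (sym (ℤ.pos-+ (F * r) (F * q)))
    r≃rᵘ : ℚ.toℚᵘ (r ÷ℕ 1) ℚᵘ.≃ mkℚᵘ (+ r) 0
    r≃rᵘ = toℚᵘ-fromℚᵘ (mkℚᵘ (+ r) 0)
    to : (P ÷ℕ F - 1ℚ) *ℚ (q ÷ℕ 1) ≤ℚ (r ÷ℕ 1) → P * q ≤ F * r + F * q
    to le with ℚᵘ.≤-respʳ-≃ r≃rᵘ (ℚᵘ.≤-respˡ-≃ (lhs≃lhsᵘ P F′ q) (toℚᵘ-mono-≤ le))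
    ... | *≤* lhsℤ≤rhsℤ = ℤ.drop‿+≤+ (subst₂ ℤ._≤_ lhsℤ+Fq rhsℤ+Fq (ℤ.+-monoˡ-≤ (+ (F * q)) lhsℤ≤rhsℤ))
    from : P * q ≤ F * r + F * q → (P ÷ℕ F - 1ℚ) *ℚ (q ÷ℕ 1) ≤ℚ (r ÷ℕ 1)
    from le = toℚᵘ-cancel-≤ (ℚᵘ.≤-respʳ-≃ (ℚᵘ.≃-sym r≃rᵘ) (ℚᵘ.≤-respˡ-≃ (ℚᵘ.≃-sym (lhs≃lhsᵘ P F′ q))
                (*≤* (+-cancelʳ-≤ℤ lhsℤ rhsℤ (+ (F * q)) (subst₂ ℤ._≤_ (sym lhsℤ+Fq) (sym rhsℤ+Fq) (ℤ.+≤+ le))))))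

open RationalCondition using (condition⇔)

δ≤degFin : ∀ n′ (x : Fin (suc n′)) → δ (suc n′) ≤ degFin n′ x
δ≤degFin n′ x = foldr-≤ (allFin (suc n′)) (∈-allFin x)
  where
  foldr-≤ : ∀ {e} xs {x} → x ∈ xs → foldr _⊓_ e (map (degFin n′) xs) ≤ degFin n′ x
  foldr-≤ (y ∷ xs) (here refl) = m⊓n≤m (degFin n′ y) _
  foldr-≤ (y ∷ xs) (there x∈xs) = ≤-trans (m⊓n≤n (degFin n′ y) _) (foldr-≤ xs x∈xs)

δ-greatest : ∀ n′ {L} → (∀ x → L ≤ degFin n′ x) → L ≤ δ (suc n′)
δ-greatest n′ {L} L≤deg = foldr-≥ (allFin (suc n′)) (L≤deg Fin.zero)
  where
  foldr-≥ : ∀ {e} xs → L ≤ e → L ≤ foldr _⊓_ e (map (degFin n′) xs)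
  foldr-≥ [] L≤e = L≤e
  foldr-≥ (y ∷ xs) L≤e = ⊓-glb (L≤deg y) (foldr-≥ xs L≤e)

≼⇔degree≤ : ∀ {c₁ c₂} d₁ d₂ → d₁ + 1 + φpart c₁ ≡ weight c₁ → d₂ + 1 + φpart c₂ ≡ weight c₂ → c₁ ≼ c₂ ⇔ d₁ ≤ d₂
≼⇔degree≤ {c₁} {c₂} d₁ d₂ deg₁ deg₂ = mk⇔
  (λ (mk≼ le) → +-cancelʳ-≤ (1 + a₁ + a₂) d₁ d₂ (begin
    d₁ + (1 + a₁ + a₂)   ≡⟨ regroup d₁ a₁ a₂ ⟩
    d₁ + 1 + a₁ + a₂     ≡⟨ cong (_+ a₂) deg₁ ⟩
    weight c₁ + a₂       ≤⟨ le ⟩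
    weight c₂ + a₁       ≡⟨ cong (_+ a₁) (sym deg₂) ⟩
    d₂ + 1 + a₂ + a₁     ≡⟨ sym (regroup′ d₂ a₁ a₂) ⟩
    d₂ + (1 + a₁ + a₂)   ∎))
  (λ d₁≤d₂ → mk≼ (begin
    weight c₁ + a₂       ≡⟨ cong (_+ a₂) (sym deg₁) ⟩
    d₁ + 1 + a₁ + a₂     ≡⟨ sym (regroup d₁ a₁ a₂) ⟩
    d₁ + (1 + a₁ + a₂)   ≤⟨ +-monoˡ-≤ (1 + a₁ + a₂) d₁≤d₂ ⟩
    d₂ + (1 + a₁ + a₂)   ≡⟨ regroup′ d₂ a₁ a₂ ⟩
    d₂ + 1 + a₂ + a₁     ≡⟨ cong (_+ a₁) deg₂ ⟩
    weight c₂ + a₁       ∎))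
  where
  open ≤-Reasoning
  a₁ a₂ : ℕ
  a₁ = φpart c₁
  a₂ = φpart c₂
  regroup : ∀ d a b → d + (1 + a + b) ≡ d + 1 + a + b
  regroup = solve-∀
  regroup′ : ∀ d a b → d + (1 + a + b) ≡ d + 1 + b + a
  regroup′ = solve-∀

R≼QR⇔ : ∀ P Φ Q R → 1 ≤ Q → 1 ≤ R
      → (P * Q , R , Φ * (Q ∸ 1)) ≼ (P , Q * R , Φ) ⇔ P * (Q ∸ 1) ≤ Φ * (R ∸ 1) + Φ * (Q ∸ 1)
R≼QR⇔ P Φ (suc q) (suc r) _ _ = mk⇔
  (λ (mk≼ le) → +-cancelˡ-≤ C _ _ (subst₂ _≤_ (regroupˡ P Φ q r) (regroupʳ P Φ q r) le))
  (λ le → mk≼ (subst₂ _≤_ (sym (regroupˡ P Φ q r)) (sym (regroupʳ P Φ q r)) (+-monoʳ-≤ C le)))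
  where
  C : ℕ
  C = P + Φ + Φ * q + Φ * q * r
  regroupˡ : ∀ P Φ q r → P * suc q + suc r * (Φ * q) + Φ ≡ (P + Φ + Φ * q + Φ * q * r) + P * q
  regroupˡ = solve-∀
  regroupʳ : ∀ P Φ q r → P + suc q * suc r * Φ + Φ * q ≡ (P + Φ + Φ * q + Φ * q * r) + (Φ * r + Φ * q)
  regroupʳ = solve-∀

-- φ(q) = q - 1 for a prime q (the case d = 1 of φ′-prime-step).
φ-prime : ∀ {q} → Prime q → φ q ≡ q ∸ 1
φ-prime {q} pq = trans (φ≡φ′ q) (trans (sym (m+n∸n≡m (φ′ q) 1)) (cong (_∸ 1) φ′q+1≡q))
  where
  φ′q+1≡q : φ′ q + 1 ≡ q
  φ′q+1≡q = trans (cong (λ t → φ′ t + 1) (sym (*-identityˡ q)))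
                  (trans (φ′-prime-step 1 q pq (λ q∣1 → prime⇒≢1 pq (∣1⇒≡1 q∣1))) (*-identityʳ q))

gcd[d,N]≡d : ∀ n′ {d} → d < suc n′ → d ∣ suc n′ → gcd (toℕ (d mod suc n′)) (suc n′) ≡ d
gcd[d,N]≡d n′ {d} d<N d∣N = begin
  gcd (toℕ (d mod suc n′)) (suc n′) ≡⟨ cong (λ t → gcd t (suc n′)) (trans (toℕ-fromℕ< (m%n<n d (suc n′))) (m<n⇒m%n≡m d<N)) ⟩
  gcd d (suc n′)                    ≡⟨ ∣-antisym (gcd[m,n]∣m d (suc n′)) (gcd-greatest ∣-refl d∣N) ⟩
  d                                 ∎
  where open ≡-Reasoning

module MinimumDegree (p : ℕ → ℕ) (k : ℕ) (1≤k : 1 ≤ k)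
  (prime : ∀ i → 1 ≤ i → i ≤ suc (suc k) → Prime (p i))
  (increasing : ∀ i j → 1 ≤ i → i < j → j ≤ suc (suc k) → p i < p j)
  (n′ : ℕ) (Πp≡N : prodUpTo p (suc (suc k)) ≡ suc n′) where

  open Splittings p (suc (suc k)) prime increasing
  open Minimum p k prime increasing

  N : ℕ
  N = suc n′

  split-degree : ∀ x {u a b} → Split p (suc (suc k)) u a (gcd (toℕ x) N) b → degFin n′ x + 1 + a ≡ u + gcd (toℕ x) N * a
  split-degree x {u} {a} s = subst (λ φu → degFin n′ x + 1 + φu ≡ u + gcd (toℕ x) N * φu) (left-φ′ ≤-refl s)
    (degree-formula n′ x u (trans (Split-∏ s) Πp≡N) (Coprime.sym (left-right-coprime ≤-refl s)))

  vertex-profile : ∀ x → Σ Profile λ c → Dominated c × degFin n′ x + 1 + φpart c ≡ weight c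
  vertex-profile x with divisor⇒Split (suc (suc k)) ≤-refl (gcd (toℕ x) N) (subst (gcd (toℕ x) N ∣_) (sym Πp≡N) (gcd[m,n]∣n (toℕ x) N))
  ... | u , a , b , s = (u , gcd (toℕ x) N , a) , dominated s , split-degree x s

  divisor-degree : ∀ {u a d b} → Split p (suc (suc k)) u a d b → d < N → degFin n′ (d mod N) + 1 + a ≡ u + d * a
  divisor-degree {u} {a} {d} s d<N = subst (λ g → degFin n′ (d mod N) + 1 + a ≡ u + g * a) gcd≡d
    (split-degree (d mod N) (subst (λ g → Split p _ u a g _) (sym gcd≡d) s))
    where
    gcd≡d : gcd (toℕ (d mod N)) N ≡ d
    gcd≡d = gcd[d,N]≡d n′ d<N (subst (d ∣_) Πp≡N (right∣Πp s))

  1≤Q : 1 ≤ Q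
  1≤Q = 1≤p (suc k) (s≤s z≤n) (n≤1+n _)

  1≤R : 1 ≤ R
  1≤R = 1≤p (suc (suc k)) (s≤s z≤n) ≤-refl

  QR<N : Q * R < N
  QR<N = subst (Q * R <_) (trans (*-comm (Q * R) P) (trans (sym (*-assoc P Q R)) Πp≡N))
    (m<m*n (Q * R) P {{>-nonZero (*-mono-≤ 1≤Q 1≤R)}} (2≤Πp k 1≤k k≤K))

  R<N : R < N
  R<N = ≤-<-trans (subst (_≤ Q * R) (*-identityˡ R) (*-monoˡ-≤ R 1≤Q)) QR<N

  degR degQR : ℕ
  degR = degFin n′ (R mod N)
  degQR = degFin n′ ((Q * R) mod N)

  split-R : Split p (suc (suc k)) (P * Q) (Φ * (Q ∸ 1)) R (R ∸ 1)
  split-R = subst₂ (Split p (suc (suc k)) (P * Q) (Φ * (Q ∸ 1))) (*-identityˡ R) (*-identityˡ (R ∸ 1)) (right (left (all-left k)))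

  split-QR : Split p (suc (suc k)) P Φ (Q * R) ((Q ∸ 1) * (R ∸ 1))
  split-QR = subst₂ (Split p (suc (suc k)) P Φ) (cong (_* R) (*-identityˡ Q)) (cong (_* (R ∸ 1)) (*-identityˡ (Q ∸ 1)))
                    (right (right (all-left k)))

  degree-R : degR + 1 + φpart profileR ≡ weight profileR
  degree-R = divisor-degree split-R R<N

  degree-QR : degQR + 1 + φpart profileQR ≡ weight profileQR
  degree-QR = divisor-degree split-QR QR<N

  δ-formula : δ N ≡ degQR ⊓ degR
  δ-formula = ≤-antisym (⊓-glb (δ≤degFin n′ ((Q * R) mod N)) (δ≤degFin n′ (R mod N))) (δ-greatest n′ lower)
    where
    lower : ∀ x → degQR ⊓ degR ≤ degFin n′ x
    lower x with vertex-profile x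
    ... | c , inj₁ R≼c , degree-c = ≤-trans (m⊓n≤n degQR degR) (Equivalence.to (≼⇔degree≤ degR (degFin n′ x) degree-R degree-c) R≼c)
    ... | c , inj₂ QR≼c , degree-c = ≤-trans (m⊓n≤m degQR degR) (Equivalence.to (≼⇔degree≤ degQR (degFin n′ x) degree-QR degree-c) QR≼c)

  δ≡degR⇔degR≤degQR : (δ N ≡ degR) ⇔ (degR ≤ degQR)
  δ≡degR⇔degR≤degQR = mk⇔ (λ δ≡degR → m⊓n≡n⇒n≤m (trans (sym δ-formula) δ≡degR)) (λ degR≤degQR → trans δ-formula (m≥n⇒m⊓n≡n degR≤degQR))

  Condition : Set
  Condition = P * (Q ∸ 1) ≤ Φ * (R ∸ 1) + Φ * (Q ∸ 1)

  degR≤degQR⇔Condition : (degR ≤ degQR) ⇔ Condition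
  degR≤degQR⇔Condition = ⇔.trans (⇔.sym (≼⇔degree≤ degR degQR degree-R degree-QR)) (R≼QR⇔ P Φ Q R 1≤Q 1≤R)

  φ[P]≡Φ : φ P ≡ Φ
  φ[P]≡Φ = trans (φ≡φ′ P) (left-φ′ k≤K (all-left k))

  φ[Q]≡Q∸1 : φ Q ≡ Q ∸ 1
  φ[Q]≡Q∸1 = φ-prime (prime (suc k) (s≤s z≤n) (n≤1+n _))

  φ[R]≡R∸1 : φ R ≡ R ∸ 1
  φ[R]≡R∸1 = φ-prime (prime (suc (suc k)) (s≤s z≤n) ≤-refl)

  rational⇔Condition : ((P ÷ℕ φ P - 1ℚ) *ℚ (φ Q ÷ℕ 1) ≤ℚ (φ R ÷ℕ 1)) ⇔ Condition
  rational⇔Condition = ⇔.trans (condition⇔ P (φ P) (φ Q) (φ R) 1≤φP) (mk⇔ (subst id cleared≡Condition) (subst id (sym cleared≡Condition)))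
    where
    1≤φP : 1 ≤ φ P
    1≤φP = subst (1 ≤_) (sym φ[P]≡Φ) (proj₂ (proj₁ (Split-pos k≤K (all-left k))))
    cleared≡Condition : (P * φ Q ≤ φ P * φ R + φ P * φ Q) ≡ Condition
    cleared≡Condition = cong₂ _≤_ (cong (P *_) φ[Q]≡Q∸1) (cong₂ _+_ (cong₂ _*_ φ[P]≡Φ φ[R]≡R∸1) (cong₂ _*_ φ[P]≡Φ φ[Q]≡Q∸1))

  δ≡degR⇔rational : (δ N ≡ degR) ⇔ ((P ÷ℕ φ P - 1ℚ) *ℚ (φ Q ÷ℕ 1) ≤ℚ (φ R ÷ℕ 1))
  δ≡degR⇔rational = ⇔.trans δ≡degR⇔degR≤degQR (⇔.trans degR≤degQR⇔Condition (⇔.sym rational⇔Condition))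

  -- Since P ≤ (k + 1) Φ, the condition holds as soon as k (Q - 1) ≤ R - 1.
  sufficient : k * φ Q ≤ φ R → δ N ≡ degR
  sufficient kφQ≤φR = Equivalence.from δ≡degR⇔degR≤degQR (Equivalence.from degR≤degQR⇔Condition (begin
    P * (Q ∸ 1)                      ≤⟨ *-monoˡ-≤ (Q ∸ 1) (Πp≤[1+j]Φp k k≤K) ⟩
    suc k * Φ * (Q ∸ 1)              ≡⟨ regroup k Φ (Q ∸ 1) ⟩
    Φ * (Q ∸ 1) + Φ * (k * (Q ∸ 1))  ≤⟨ +-monoʳ-≤ (Φ * (Q ∸ 1)) (*-monoʳ-≤ Φ k[Q-1]≤R-1) ⟩
    Φ * (Q ∸ 1) + Φ * (R ∸ 1)        ≡⟨ +-comm (Φ * (Q ∸ 1)) (Φ * (R ∸ 1)) ⟩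
    Φ * (R ∸ 1) + Φ * (Q ∸ 1)        ∎))
    where
    open ≤-Reasoning
    k[Q-1]≤R-1 : k * (Q ∸ 1) ≤ R ∸ 1
    k[Q-1]≤R-1 = subst₂ (λ φQ φR → k * φQ ≤ φR) φ[Q]≡Q∸1 φ[R]≡R∸1 kφQ≤φR
    regroup : ∀ k F q → suc k * F * q ≡ F * q + F * (k * q)
    regroup = solve-∀

  minimum-degree : δ (Πp (suc (suc k))) ≡ deg (Πp (suc (suc k))) (Q * R) ⊓ deg (Πp (suc (suc k))) R
  minimum-degree = subst (λ M → δ M ≡ deg M (Q * R) ⊓ deg M R) (sym Πp≡N) δ-formula

  minimum-at-R⇔ : (δ (Πp (suc (suc k))) ≡ deg (Πp (suc (suc k))) R) ⇔ ((P ÷ℕ φ P - 1ℚ) *ℚ (φ Q ÷ℕ 1) ≤ℚ (φ R ÷ℕ 1))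
  minimum-at-R⇔ = subst (λ M → (δ M ≡ deg M R) ⇔ ((P ÷ℕ φ P - 1ℚ) *ℚ (φ Q ÷ℕ 1) ≤ℚ (φ R ÷ℕ 1))) (sym Πp≡N) δ≡degR⇔rational

  minimum-at-R : k * φ Q ≤ φ R → δ (Πp (suc (suc k))) ≡ deg (Πp (suc (suc k))) R
  minimum-at-R = subst (λ M → k * φ Q ≤ φ R → δ M ≡ deg M R) (sym Πp≡N) sufficient

theorem1p2 : (r : ℕ) → 3 ≤ r → (p : ℕ → ℕ)
    → (∀ i → 1 ≤ i → i ≤ r → Prime (p i))
    → (∀ i j → 1 ≤ i → i < j → j ≤ r → p i < p j)
    → let n = prodUpTo p r
          P = prodUpTo p (r ∸ 2)
      in (δ n ≡ deg n (p (r ∸ 1) * p r) ⊓ deg n (p r))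
         × ((δ n ≡ deg n (p r))
             ⇔ ((P ÷ℕ φ P - 1ℚ) *ℚ (φ (p (r ∸ 1)) ÷ℕ 1) ≤ℚ (φ (p r) ÷ℕ 1)))
         × ((r ∸ 2) * φ (p (r ∸ 1)) ≤ φ (p r) → δ n ≡ deg n (p r))
theorem1p2 1 (s≤s ())
theorem1p2 2 (s≤s (s≤s ()))
theorem1p2 (suc (suc (suc k))) _ p prime increasing = minimum-degree , minimum-at-R⇔ , minimum-at-R
  where
  N : ℕ
  N = prodUpTo p (suc (suc (suc k)))
  instance
    N≢0 : NonZero N
    N≢0 = >-nonZero (≤-trans (n≤1+n 1) (Splittings.2≤Πp p (suc (suc (suc k))) prime increasing (suc (suc (suc k))) (s≤s z≤n) ≤-refl))
  open MinimumDegree p (suc k) (s≤s z≤n) prime increasing (pred N) (sym (suc-pred N))
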